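{- Every graph $G$ with $tb(G)\le 1$ admits a domination elimination ordering.
   Context: Graphs are finite, simple, connected and unweighted. $tb(G)$ is the tree-breadth: the minimum, over tree decompositions $(T,(X_t))$ of $G$, of $\max_t\min_{v\in V(G)}\max_{w\in X_t}dist_G(v,w)$ (a tree decomposition being a tree with vertex-subsets as bags covering all vertices and all edges, the bags containing any given vertex inducing a subtree). A domination elimination ordering of $G$ is a total ordering $v_1,\dots,v_n$ of its vertices such that for every $1\le i<n$ there is $j>i$ with $N_G(v_i)\cap\{v_{i+1},\dots,v_n\}\subseteq N_G[v_j]$. -}

module Defs where

open import Data.Nat using (ℕ; zero; suc; _≤_; _<_)
open import Data.Fin as Fin using (Fin; toℕ; inject₁; fromℕ)
open import Data.Bool using (Bool; T)
open import Data.Product using (Σ; ∃; _×_; _,_)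
open import Data.Sum using (_⊎_)
open import Relation.Nullary using (¬_)
open import Relation.Binary.PropositionalEquality using (_≡_)
open import Function.Definitions using (Injective)

record Graph (n : ℕ) : Set where
  field
    adj       : Fin n → Fin n → Bool
    adj-irrefl : ∀ v → ¬ T (adj v v)
    adj-sym   : ∀ u v → T (adj u v) → T (adj v u)

open Graph public

Adj : ∀ {n} → Graph n → Fin n → Fin n → Set
Adj G u v = T (adj G u v)

data Walk {n : ℕ} (G : Graph n) : Fin n → Fin n → ℕ → Set where
  nil  : ∀ {v} → Walk G v v zero
  cons : ∀ {u w v k} → Adj G u w → Walk G w v k → Walk G u v (suc k)

Connected : ∀ {n} → Graph n → Set
Connected G = ∀ u v → ∃ λ k → Walk G u v k

DistLe : ∀ {n} → Graph n → Fin n → Fin n → ℕ → Set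
DistLe G u v k = ∃ λ j → j ≤ k × Walk G u v j

HasCycle : ∀ {m} → Graph m → Set
HasCycle {m} T' = Σ ℕ λ k → Σ (Fin (suc (suc (suc k))) → Fin m) λ c →
  Injective _≡_ _≡_ c ×
  (∀ (i : Fin (suc (suc k))) → Adj T' (c (inject₁ i)) (c (Fin.suc i))) ×
  Adj T' (c (fromℕ (suc (suc k)))) (c Fin.zero)

Acyclic : ∀ {m} → Graph m → Set
Acyclic T' = ¬ HasCycle T'

IsTree : ∀ {m} → Graph m → Set
IsTree T' = Connected T' × Acyclic T'

data WalkIn {m : ℕ} (T' : Graph m) (P : Fin m → Set) : Fin m → Fin m → Set where
  here  : ∀ {t} → P t → WalkIn T' P t t
  step  : ∀ {s r t} → P s → Adj T' s r → WalkIn T' P r t → WalkIn T' P s t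

record TreeDecomposition {n : ℕ} (G : Graph n) : Set₁ where
  field
    m       : ℕ
    tree    : Graph m
    isTree  : IsTree tree
    bag     : Fin m → Fin n → Set
    cover-vertices : ∀ v → ∃ λ t → bag t v
    cover-edges    : ∀ u v → Adj G u v → ∃ λ t → bag t u × bag t v
    -- the bags containing v induce a connected subtree
    subtree        : ∀ v s t → bag s v → bag t v →
                     WalkIn tree (λ r → bag r v) s t

open TreeDecomposition public

TreeBreadthLe1 : ∀ {n} → Graph n → Set₁
TreeBreadthLe1 {n} G = Σ (TreeDecomposition G) λ D →
  ∀ (t : Fin (m D)) → ∃ λ (v : Fin n) → ∀ w → bag D t w → DistLe G v w 1

-- Domination elimination ordering: ord i = v_i, an injective (hence
-- bijective) map positions → vertices. For every non-last position i there is
-- j > i with N(v_i) ∩ {v_k : k > i} ⊆ N[v_j].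
IsDEO : ∀ {n} → Graph n → (Fin n → Fin n) → Set
IsDEO {n} G ord = Injective _≡_ _≡_ ord ×
  (∀ (i : Fin n) → suc (toℕ i) < n →
    ∃ λ (j : Fin n) → i Fin.< j ×
      (∀ (k : Fin n) → i Fin.< k → Adj G (ord i) (ord k) →
         ord k ≡ ord j ⊎ Adj G (ord j) (ord k)))

HasDEO : ∀ {n} → Graph n → Set
HasDEO {n} G = Σ (Fin n → Fin n) λ ord → IsDEO G ord

-- Every bag of a breadth-1 tree decomposition lies in the closed neighbourhood
-- N[c] of a centre c.  Call u private to a leaf t of the decomposition forest
-- if no neighbouring bag contains u; then N(u) ⊆ bag t ⊆ N[centre t], so u is
-- dominated by centre t unless u is that centre.  In a graph without dominated
-- vertices a leaf bag therefore has at most one private vertex and it is the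
-- centre, which forces the bag of an isolated leaf to be empty and the bag of a
-- pendant leaf into N[c'] for the centre c' of its neighbour.  Either way the
-- leaf can be removed, and repeating this exhausts the forest: every graph with
-- at least two vertices and a breadth-1 decomposition has a dominated vertex u,
-- N(u) ⊆ N[w] with u ≠ w.  Deleting u keeps breadth 1 (a bag centred at u is
-- recentred at w), and putting u in front of a domination elimination ordering
-- of G − u gives one of G, with w as the witness for u.
module Submission where

open import Data.Nat as ℕ using (ℕ; zero; suc; _≤_; _<_; z≤n; s≤s; _+_)
open import Data.Nat.Induction using (<-wellFounded)
import Data.Nat.Properties as ℕ
open import Data.Fin as Fin using (Fin; toℕ; inject₁; inject≤; fromℕ; punchIn; punchOut; _≟_)
open import Data.Fin.Properties
  using (any?; all?; pigeonhole; punchIn-injective; punchInᵢ≢i; punchIn-punchOut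
        ; toℕ-injective; toℕ<n; toℕ-inject₁; toℕ-inject≤; toℕ-fromℕ; inject≤-injective)
open import Data.Fin.Subset using (Subset; _∈_; _-_; ∣_∣; ⊤)
open import Data.Fin.Subset.Properties using (_∈?_; ∈⊤; x∈p∧x≢y⇒x∈p-y; x∈p⇒∣p-x∣<∣p∣)
open import Data.Fin.Permutation using (Permutation′; insert; id; _⟨$⟩ʳ_; _⟨$⟩ˡ_; inverseʳ)
open import Data.Bool using (T)
open import Data.Product using (Σ; ∃; ∃₂; _×_; _,_; proj₁; proj₂)
open import Data.Sum using (_⊎_; inj₁; inj₂; map₁)
open import Data.Empty using (⊥; ⊥-elim)
open import Function using (_∘_; _on_)
open import Function.Definitions using (Injective)
open import Function.Bundles using (Injection)
open import Function.Properties.Inverse using (↔⇒↣)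
import Induction.WellFounded as WF
open import Level using (0ℓ)
import Relation.Binary.Construct.On as On
open import Relation.Nullary using (¬_; Dec; yes; no)
open import Relation.Nullary.Decidable using (T?; ¬?; _×-dec_; _⊎-dec_; _→-dec_; decidable-stable)
open import Relation.Binary.PropositionalEquality
  using (_≡_; _≢_; refl; sym; trans; cong; subst; subst₂)
open import Defs

ClosedNbhd : ∀ {n} → Graph n → Fin n → Fin n → Set
ClosedNbhd G c x = x ≡ c ⊎ Adj G c x

closedNbhd? : ∀ {n} (G : Graph n) c x → Dec (ClosedNbhd G c x)
closedNbhd? G c x = x ≟ c ⊎-dec T? (adj G c x)

closedNbhd-of-distLe1 : ∀ {n} (G : Graph n) {c x} → DistLe G c x 1 → ClosedNbhd G c x
closedNbhd-of-distLe1 G (zero , _ , nil) = inj₁ refl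
closedNbhd-of-distLe1 G (suc zero , _ , cons c~x nil) = inj₂ c~x
closedNbhd-of-distLe1 G (suc (suc _) , s≤s () , _)

Dominated : ∀ {n} → Graph n → Fin n → Fin n → Set
Dominated G u w = u ≢ w × (∀ x → Adj G u x → ClosedNbhd G w x)

HasDominatedVertex : ∀ {n} → Graph n → Set
HasDominatedVertex G = ∃₂ λ u w → Dominated G u w

hasDominatedVertex? : ∀ {n} (G : Graph n) → Dec (HasDominatedVertex G)
hasDominatedVertex? G = any? λ u → any? λ w →
  ¬? (u ≟ w) ×-dec all? (λ x → T? (adj G u x) →-dec closedNbhd? G w x)

deleteVertex : ∀ {n} → Graph (suc n) → Fin (suc n) → Graph n
deleteVertex G u = record
  { adj        = λ x y → adj G (punchIn u x) (punchIn u y)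
  ; adj-irrefl = λ x → adj-irrefl G (punchIn u x)
  ; adj-sym    = λ x y → adj-sym G (punchIn u x) (punchIn u y)
  }

-- Orderings are built as permutations so that the position of a vertex, needed
-- as the witness j in IsDEO, is available through the inverse.
DEOPermutation : ∀ {n} → Graph n → Set
DEOPermutation {n} G = Σ (Permutation′ n) λ π → IsDEO G (π ⟨$⟩ʳ_)

permutation-injective : ∀ {n} (π : Permutation′ n) → Injective _≡_ _≡_ (π ⟨$⟩ʳ_)
permutation-injective π = Injection.injective (↔⇒↣ π)

deo-≤1 : ∀ {n} (G : Graph n) → n ≤ 1 → DEOPermutation G
deo-≤1 G n≤1 = id , permutation-injective id , λ i i+1<n →
  ⊥-elim (ℕ.n≮0 (ℕ.≤-pred (ℕ.<-≤-trans i+1<n n≤1)))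

deo-insertDominated : ∀ {n} {G : Graph (suc n)} {u w} → Dominated G u w →
                      DEOPermutation (deleteVertex G u) → DEOPermutation G
deo-insertDominated {G = G} {u} {w} (u≢w , u⊆N[w]) (π , _ , laterDominated) =
  σ , permutation-injective σ , dominatedLater
  where
  σ : Permutation′ _
  σ = insert Fin.zero u π

  wPosition : Fin _
  wPosition = Fin.suc (π ⟨$⟩ˡ punchOut u≢w)

  σ-wPosition : σ ⟨$⟩ʳ wPosition ≡ w
  σ-wPosition = trans (cong (punchIn u) (inverseʳ π)) (punchIn-punchOut u≢w)

  dominatedLater : ∀ i → suc (toℕ i) < suc _ → ∃ λ j → i Fin.< j ×
    (∀ k → i Fin.< k → Adj G (σ ⟨$⟩ʳ i) (σ ⟨$⟩ʳ k) →
       σ ⟨$⟩ʳ k ≡ σ ⟨$⟩ʳ j ⊎ Adj G (σ ⟨$⟩ʳ j) (σ ⟨$⟩ʳ k))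
  dominatedLater Fin.zero _ = wPosition , s≤s z≤n , λ k _ u~k →
    subst (λ z → σ ⟨$⟩ʳ k ≡ z ⊎ Adj G z (σ ⟨$⟩ʳ k)) (sym σ-wPosition) (u⊆N[w] _ u~k)
  dominatedLater (Fin.suc i) (s≤s i+1<n) with j , i<j , later ← laterDominated i i+1<n =
    Fin.suc j , s≤s i<j , λ where
      Fin.zero ()
      (Fin.suc k) (s≤s i<k) a → map₁ (cong (punchIn u)) (later k i<k a)

-- Only acyclicity of the tree is kept, and nodes are discarded by removing them
-- from 'nodes' rather than from the forest; discarded nodes have empty bags.
record CentredDecomposition {n : ℕ} (G : Graph n) : Set₁ where
  field
    m              : ℕ
    tree           : Graph m
    acyclic        : Acyclic tree
    nodes          : Subset m
    bag            : Fin m → Fin n → Set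
    centre         : Fin m → Fin n
    bag⊆nodes      : ∀ t x → bag t x → t ∈ nodes
    bag⊆N[centre]  : ∀ t x → bag t x → ClosedNbhd G (centre t) x
    cover-vertices : ∀ v → ∃ λ t → bag t v
    cover-edges    : ∀ u v → Adj G u v → ∃ λ t → bag t u × bag t v
    subtree        : ∀ v s t → bag s v → bag t v → WalkIn tree (λ r → bag r v) s t

open CentredDecomposition

fromTreeBreadthLe1 : ∀ {n} {G : Graph n} → TreeBreadthLe1 G → CentredDecomposition G
fromTreeBreadthLe1 {G = G} (D , centred) = record
  { m              = m D
  ; tree           = tree D
  ; acyclic        = proj₂ (isTree D)
  ; nodes          = ⊤
  ; bag            = bag D
  ; centre         = λ t → proj₁ (centred t)
  ; bag⊆nodes      = λ _ _ _ → ∈⊤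
  ; bag⊆N[centre]  = λ t x x∈t → closedNbhd-of-distLe1 G (proj₂ (centred t) x x∈t)
  ; cover-vertices = cover-vertices D
  ; cover-edges    = cover-edges D
  ; subtree        = subtree D
  }

-- Centres renamed for G − u, the centre u being replaced by its dominator w.
recentre : ∀ {n} {u w : Fin (suc n)} → u ≢ w → Fin (suc n) → Fin n
recentre {u = u} u≢w c with u ≟ c
... | yes _   = punchOut u≢w
... | no u≢c  = punchOut u≢c

closedNbhd-deleteVertex : ∀ {n} (G : Graph (suc n)) {u c x} (u≢c : u ≢ c) →
  ClosedNbhd G c (punchIn u x) → ClosedNbhd (deleteVertex G u) (punchOut u≢c) x
closedNbhd-deleteVertex G {u} {x = x} u≢c x∈N[c]
  with subst (λ z → ClosedNbhd G z (punchIn u x)) (sym (punchIn-punchOut u≢c)) x∈N[c]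
... | inj₁ x≡c = inj₁ (punchIn-injective u _ _ x≡c)
... | inj₂ c~x = inj₂ c~x

closedNbhd-recentre : ∀ {n} (G : Graph (suc n)) {u w c x} (d : Dominated G u w) →
  ClosedNbhd G c (punchIn u x) → ClosedNbhd (deleteVertex G u) (recentre (proj₁ d) c) x
closedNbhd-recentre G {u} {c = c} {x} (u≢w , u⊆N[w]) x∈N[c] with u ≟ c
... | no u≢c   = closedNbhd-deleteVertex G u≢c x∈N[c]
... | yes refl with x∈N[c]
...   | inj₁ x≡u = ⊥-elim (punchInᵢ≢i u x x≡u)
...   | inj₂ u~x = closedNbhd-deleteVertex G u≢w (u⊆N[w] _ u~x)

deleteDominated : ∀ {n} {G : Graph (suc n)} {u w} → Dominated G u w →
                  CentredDecomposition G → CentredDecomposition (deleteVertex G u)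
deleteDominated {G = G} {u} d D = record
  { m              = m D
  ; tree           = tree D
  ; acyclic        = acyclic D
  ; nodes          = nodes D
  ; bag            = λ t x → bag D t (punchIn u x)
  ; centre         = λ t → recentre (proj₁ d) (centre D t)
  ; bag⊆nodes      = λ t x → bag⊆nodes D t (punchIn u x)
  ; bag⊆N[centre]  = λ t x x∈t → closedNbhd-recentre G d (bag⊆N[centre] D t (punchIn u x) x∈t)
  ; cover-vertices = λ v → cover-vertices D (punchIn u v)
  ; cover-edges    = λ x y → cover-edges D (punchIn u x) (punchIn u y)
  ; subtree        = λ v → subtree D (punchIn u v)
  }

walkIn-start : ∀ {m} {F : Graph m} {P : Fin m → Set} {s t} → WalkIn F P s t → P s
walkIn-start (here Ps)     = Ps
walkIn-start (step Ps _ _) = Ps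

mapWalkIn : ∀ {m m′} {F : Graph m} {F′ : Graph m′} {P : Fin m → Set} {Q : Fin m′ → Set}
  (f : Fin m → Fin m′) → (∀ x → P x → Q (f x)) →
  (∀ x y → P x → P y → Adj F x y → f x ≡ f y ⊎ Adj F′ (f x) (f y)) →
  ∀ {s t} → WalkIn F P s t → WalkIn F′ Q (f s) (f t)
mapWalkIn f P⇒Q edge (here Pt) = here (P⇒Q _ Pt)
mapWalkIn {F′ = F′} {Q = Q} f P⇒Q edge {t = t} (step Ps s~r walk)
  with edge _ _ Ps (walkIn-start walk) s~r
... | inj₁ fs≡fr  = subst (λ z → WalkIn F′ Q z (f t)) (sym fs≡fr) (mapWalkIn f P⇒Q edge walk)
... | inj₂ fs~fr  = step (P⇒Q _ Ps) fs~fr (mapWalkIn f P⇒Q edge walk)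

data Leaf {m} (F : Graph m) (p : Subset m) : Set where
  isolated : ∀ t → t ∈ p → (∀ r → r ∈ p → ¬ Adj F t r) → Leaf F p
  pendant  : ∀ t s → t ∈ p → s ∈ p → Adj F t s →
             (∀ r → r ∈ p → Adj F t r → r ≡ s) → Leaf F p

record Path {m} (F : Graph m) (p : Subset m) (L : ℕ) : Set where
  field
    vertex    : Fin (suc L) → Fin m
    injective : Injective _≡_ _≡_ vertex
    adjacent  : ∀ (i : Fin L) → Adj F (vertex (inject₁ i)) (vertex (Fin.suc i))
    inside    : ∀ i → vertex i ∈ p

open Path

module _ {m} {F : Graph m} {p : Subset m} where

  singletonPath : ∀ {x} → x ∈ p → Path F p 0
  singletonPath {x} x∈p = record
    { vertex    = λ _ → x
    ; injective = λ { {Fin.zero} {Fin.zero} _ → refl }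
    ; adjacent  = λ ()
    ; inside    = λ _ → x∈p
    }

  consPath : ∀ {L r} (P : Path F p L) → r ∈ p → Adj F r (vertex P Fin.zero) →
             (∀ i → vertex P i ≢ r) → Path F p (suc L)
  consPath {L} {r} P r∈p r~v₀ fresh = record
    { vertex = vertex′ ; injective = injective′ ; adjacent = adjacent′ ; inside = inside′ }
    where
    vertex′ : Fin (suc (suc L)) → Fin m
    vertex′ Fin.zero    = r
    vertex′ (Fin.suc i) = vertex P i
    injective′ : Injective _≡_ _≡_ vertex′
    injective′ {Fin.zero}  {Fin.zero}  _ = refl
    injective′ {Fin.zero}  {Fin.suc j} e = ⊥-elim (fresh j (sym e))
    injective′ {Fin.suc i} {Fin.zero}  e = ⊥-elim (fresh i e)
    injective′ {Fin.suc i} {Fin.suc j} e = cong Fin.suc (injective P e)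
    adjacent′ : ∀ (i : Fin (suc L)) → Adj F (vertex′ (inject₁ i)) (vertex′ (Fin.suc i))
    adjacent′ Fin.zero    = r~v₀
    adjacent′ (Fin.suc i) = adjacent P i
    inside′ : ∀ i → vertex′ i ∈ p
    inside′ Fin.zero    = r∈p
    inside′ (Fin.suc i) = inside P i

  prefix : ∀ {L} (P : Path F p L) (i : Fin (suc L)) → Path F p (toℕ i)
  prefix {L} P i = record
    { vertex    = vertex P ∘ embed
    ; injective = inject≤-injective _ _ _ _ ∘ injective P
    ; adjacent  = λ j → subst₂ (Adj F) (vertex-cong (toℕ-last j)) (vertex-cong (toℕ-next j))
                                        (adjacent P (inject≤ j i≤L))
    ; inside    = inside P ∘ embed
    }
    where
    i≤L : toℕ i ≤ L
    i≤L = ℕ.≤-pred (toℕ<n i)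
    embed : Fin (suc (toℕ i)) → Fin (suc L)
    embed j = inject≤ j (toℕ<n i)
    vertex-cong : ∀ {a b} → toℕ a ≡ toℕ b → vertex P a ≡ vertex P b
    vertex-cong = cong (vertex P) ∘ toℕ-injective
    toℕ-last : ∀ j → toℕ (inject₁ (inject≤ j i≤L)) ≡ toℕ (embed (inject₁ j))
    toℕ-last j = trans (toℕ-inject₁ _) (trans (toℕ-inject≤ j i≤L)
                   (sym (trans (toℕ-inject≤ (inject₁ j) (toℕ<n i)) (toℕ-inject₁ j))))
    toℕ-next : ∀ j → toℕ (Fin.suc (inject≤ j i≤L)) ≡ toℕ (embed (Fin.suc j))
    toℕ-next j = trans (cong suc (toℕ-inject≤ j i≤L)) (sym (toℕ-inject≤ (Fin.suc j) (toℕ<n i)))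

  prefix-end : ∀ {L} (P : Path F p L) i → vertex (prefix P i) (fromℕ (toℕ i)) ≡ vertex P i
  prefix-end P i = cong (vertex P) (toℕ-injective
    (trans (toℕ-inject≤ (fromℕ (toℕ i)) (toℕ<n i)) (toℕ-fromℕ (toℕ i))))

  backEdge⇒cycle : ∀ {L} (P : Path F p (suc L)) (j : Fin L) →
    Adj F (vertex P (Fin.suc (Fin.suc j))) (vertex P Fin.zero) → HasCycle F
  backEdge⇒cycle P j back =
    toℕ j , vertex P′ , injective P′ , adjacent P′ ,
    subst (λ z → Adj F z (vertex P Fin.zero)) (sym (prefix-end P (Fin.suc (Fin.suc j)))) back
    where
    P′ = prefix P (Fin.suc (Fin.suc j))

  path-length≱ : ∀ {L} → Path F p L → ¬ m ≤ L
  path-length≱ P m≤L with i , j , i<j , vᵢ≡vⱼ ← pigeonhole (s≤s m≤L) (vertex P) =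
    ℕ.<-irrefl (cong toℕ (injective P vᵢ≡vⱼ)) i<j

module _ {m} {F : Graph m} (acyclic : Acyclic F) {p : Subset m} where

  neighbourOnPath⇒index≡1 : ∀ {L} (P : Path F p L) i → Adj F (vertex P Fin.zero) (vertex P i) → toℕ i ≡ 1
  neighbourOnPath⇒index≡1 P Fin.zero               v₀~vᵢ = ⊥-elim (adj-irrefl F _ v₀~vᵢ)
  neighbourOnPath⇒index≡1 P (Fin.suc Fin.zero)     _     = refl
  neighbourOnPath⇒index≡1 P (Fin.suc (Fin.suc j))  v₀~vᵢ = ⊥-elim (acyclic (backEdge⇒cycle P j (adj-sym F _ _ v₀~vᵢ)))

  maximalPath⇒leaf : ∀ {L} (P : Path F p L) →
    (∀ r → r ∈ p → Adj F (vertex P Fin.zero) r → ∃ λ i → vertex P i ≡ r) → Leaf F p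
  maximalPath⇒leaf {zero} P onPath = isolated _ (inside P Fin.zero) noNeighbour
    where
    noNeighbour : ∀ r → r ∈ p → ¬ Adj F (vertex P Fin.zero) r
    noNeighbour r r∈p v₀~r with Fin.zero , refl ← onPath r r∈p v₀~r = adj-irrefl F _ v₀~r
  maximalPath⇒leaf {suc L} P onPath =
    pendant _ _ (inside P Fin.zero) (inside P (Fin.suc Fin.zero)) (adjacent P Fin.zero) onlyNeighbour
    where
    onlyNeighbour : ∀ r → r ∈ p → Adj F (vertex P Fin.zero) r → r ≡ vertex P (Fin.suc Fin.zero)
    onlyNeighbour r r∈p v₀~r with i , refl ← onPath r r∈p v₀~r =
      cong (vertex P) (toℕ-injective (neighbourOnPath⇒index≡1 P i v₀~r))

  -- Extend the path at vertex 0 while a fresh neighbour in p exists; the fuel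
  -- suffices because a path in F has fewer than m edges.
  grow : ∀ fuel {L} → m ≤ fuel + L → Path F p L → Leaf F p
  grow zero       m≤L P = ⊥-elim (path-length≱ P m≤L)
  grow (suc fuel) {L} m≤ P
    with any? (λ r → r ∈? p ×-dec T? (adj F (vertex P Fin.zero) r) ×-dec ¬? (any? λ i → vertex P i ≟ r))
  ... | yes (r , r∈p , v₀~r , fresh) =
    grow fuel (subst (m ≤_) (sym (ℕ.+-suc fuel L)) m≤) (consPath P r∈p (adj-sym F _ _ v₀~r) (λ i e → fresh (i , e)))
  ... | no noFresh = maximalPath⇒leaf P λ r r∈p v₀~r →
    decidable-stable (any? λ i → vertex P i ≟ r) λ off → noFresh (r , r∈p , v₀~r , off)

  leaf : ∀ {x} → x ∈ p → Leaf F p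
  leaf x∈p = grow m (ℕ.≤-reflexive (sym (ℕ.+-identityʳ m))) (singletonPath x∈p)

_≺_ : ∀ {n} {G : Graph n} → CentredDecomposition G → CentredDecomposition G → Set
_≺_ = _<_ on (∣_∣ ∘ nodes)

module _ {n} {G : Graph n} (D : CentredDecomposition G) where

  dropEmptyNode : ∀ {t} → t ∈ nodes D → (∀ v → ¬ bag D t v) → ∃ λ D′ → D′ ≺ D
  dropEmptyNode {t} t∈nodes empty =
    record D { nodes = nodes D - t ; bag⊆nodes = bag⊆nodes′ } , x∈p⇒∣p-x∣<∣p∣ t∈nodes
    where
    bag⊆nodes′ : ∀ r x → bag D r x → r ∈ nodes D - t
    bag⊆nodes′ r x x∈r = x∈p∧x≢y⇒x∈p-y (bag⊆nodes D r x x∈r) λ { refl → empty x x∈r }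

  contractPendant : ∀ {t s} → t ∈ nodes D → s ∈ nodes D → Adj (tree D) t s →
    (∀ r → r ∈ nodes D → Adj (tree D) t r → r ≡ s) →
    (∀ v → bag D t v → ClosedNbhd G (centre D s) v) → ∃ λ D′ → D′ ≺ D
  contractPendant {t} {s} t∈nodes s∈nodes t~s onlyS bagₜ⊆N[cₛ] = record D
    { nodes          = nodes D - t
    ; bag            = bag′
    ; bag⊆nodes      = λ { _ x (r , refl , x∈r) → merge-node r x x∈r }
    ; bag⊆N[centre]  = λ { _ x (r , refl , x∈r) → merge-centre r x x∈r }
    ; cover-vertices = λ v → let r , v∈r = cover-vertices D v in merge r , r , refl , v∈r
    ; cover-edges    = λ u v u~v → let r , u∈r , v∈r = cover-edges D u v u~v in
                                   merge r , (r , refl , u∈r) , (r , refl , v∈r)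
    ; subtree        = subtree′
    } , x∈p⇒∣p-x∣<∣p∣ t∈nodes
    where
    merge : Fin (m D) → Fin (m D)
    merge r with r ≟ t
    ... | yes _ = s
    ... | no _  = r

    bag′ : Fin (m D) → Fin n → Set
    bag′ r v = ∃ λ r₀ → merge r₀ ≡ r × bag D r₀ v

    s≢t : s ≢ t
    s≢t refl = adj-irrefl (tree D) t t~s

    merge-node : ∀ r x → bag D r x → merge r ∈ nodes D - t
    merge-node r x x∈r with r ≟ t
    ... | yes _   = x∈p∧x≢y⇒x∈p-y s∈nodes s≢t
    ... | no r≢t  = x∈p∧x≢y⇒x∈p-y (bag⊆nodes D r x x∈r) r≢t

    merge-centre : ∀ r x → bag D r x → ClosedNbhd G (centre D (merge r)) x
    merge-centre r x x∈r with r ≟ t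
    ... | yes refl = bagₜ⊆N[cₛ] x x∈r
    ... | no _     = bag⊆N[centre] D r x x∈r

    merge-edge : ∀ v x y → bag D x v → bag D y v → Adj (tree D) x y →
                 merge x ≡ merge y ⊎ Adj (tree D) (merge x) (merge y)
    merge-edge v x y v∈x v∈y x~y with x ≟ t | y ≟ t
    ... | yes refl | yes refl = inj₁ refl
    ... | yes refl | no _     = inj₁ (sym (onlyS y (bag⊆nodes D y v v∈y) x~y))
    ... | no _     | yes refl = inj₁ (onlyS x (bag⊆nodes D x v v∈x) (adj-sym (tree D) x t x~y))
    ... | no _     | no _     = inj₂ x~y

    subtree′ : ∀ v a b → bag′ a v → bag′ b v → WalkIn (tree D) (λ r → bag′ r v) a b
    subtree′ v _ _ (a , refl , v∈a) (b , refl , v∈b) =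
      mapWalkIn merge (λ r v∈r → r , refl , v∈r) (merge-edge v) (subtree D v a b v∈a v∈b)

module Undominated {n} (G : Graph (suc (suc n))) (undominated : ¬ HasDominatedVertex G) where

  ≡-dominator : ∀ {u w} → (∀ x → Adj G u x → ClosedNbhd G w x) → u ≡ w
  ≡-dominator {u} {w} N[u]⊆N[w] = decidable-stable (u ≟ w) λ u≢w → undominated (u , w , u≢w , N[u]⊆N[w])

  module _ (D : CentredDecomposition G) where

    Private : Fin (m D) → Fin (suc (suc n)) → Set
    Private t u = bag D t u × (∀ r → r ∈ nodes D → Adj (tree D) t r → ¬ bag D r u)

    private-unique : ∀ {t u t′} → Private t u → bag D t′ u → t′ ≡ t
    private-unique {t} {u} {t′} (u∈t , notNearby) u∈t′ with subtree D u t t′ u∈t u∈t′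
    ... | here _          = refl
    ... | step _ t~r walk = ⊥-elim (notNearby _ (bag⊆nodes D _ u (walkIn-start walk)) t~r (walkIn-start walk))

    private⇒neighbours∈bag : ∀ {t u x} → Private t u → Adj G u x → bag D t x
    private⇒neighbours∈bag {x = x} pu u~x with r , u∈r , x∈r ← cover-edges D _ x u~x =
      subst (λ r → bag D r x) (private-unique pu u∈r) x∈r

    private⇒centre : ∀ {t u} → Private t u → u ≡ centre D t
    private⇒centre pu = ≡-dominator λ x u~x → bag⊆N[centre] D _ x (private⇒neighbours∈bag pu u~x)

    private-independent : ∀ {t u x} → Private t u → Private t x → ¬ Adj G u x
    private-independent {u = u} pu px u~x =
      adj-irrefl G u (subst (Adj G u) (trans (private⇒centre px) (sym (private⇒centre pu))) u~x)

    -- A vertex v of an isolated bag has no neighbours, so it is dominated by both 0 and 1.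
    isolated-empty : ∀ {t} → (∀ r → r ∈ nodes D → ¬ Adj (tree D) t r) → ∀ v → ¬ bag D t v
    isolated-empty {t} noNeighbourₜ v v∈t = 0≢1 (trans (sym (≡-dominator noNeighbour)) (≡-dominator noNeighbour))
      where
      private-in-t : ∀ {x} → bag D t x → Private t x
      private-in-t x∈t = x∈t , λ r r∈nodes t~r _ → noNeighbourₜ r r∈nodes t~r
      noNeighbour : ∀ {w} x → Adj G v x → ClosedNbhd G w x
      noNeighbour x v~x = ⊥-elim (private-independent (private-in-t v∈t)
        (private-in-t (private⇒neighbours∈bag (private-in-t v∈t) v~x)) v~x)
      0≢1 : Fin.zero {suc n} ≢ Fin.suc Fin.zero
      0≢1 ()

    -- A vertex of bag t outside N[centre s] would be private and be the centre of t,
    -- and so would be each of its neighbours outside N[centre s]; hence all its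
    -- neighbours lie in N[centre s], and undominatedness makes it centre s itself.
    pendant-bag⊆ : ∀ {t s} → (∀ r → r ∈ nodes D → Adj (tree D) t r → r ≡ s) →
                   ∀ v → bag D t v → ClosedNbhd G (centre D s) v
    pendant-bag⊆ {t} {s} onlyS v v∈t =
      decidable-stable (closedNbhd? G _ v) λ v∉N → v∉N (inj₁ (≡-dominator (neighbours v∉N)))
      where
      outside⇒private : ∀ {x} → bag D t x → ¬ ClosedNbhd G (centre D s) x → Private t x
      outside⇒private {x} x∈t x∉N = x∈t , λ r r∈nodes t~r x∈r →
        x∉N (bag⊆N[centre] D s x (subst (λ z → bag D z x) (onlyS r r∈nodes t~r) x∈r))
      neighbours : ¬ ClosedNbhd G (centre D s) v → ∀ x → Adj G v x → ClosedNbhd G (centre D s) x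
      neighbours v∉N x v~x = decidable-stable (closedNbhd? G _ x) λ x∉N →
        private-independent pv (outside⇒private (private⇒neighbours∈bag pv v~x) x∉N) v~x
        where
        pv = outside⇒private v∈t v∉N

    removeLeaf : ∃ λ D′ → D′ ≺ D
    removeLeaf with leaf {F = tree D} (acyclic D) (bag⊆nodes D _ _ (proj₂ (cover-vertices D Fin.zero)))
    ... | isolated t t∈nodes noNeighbour =
      dropEmptyNode D t∈nodes (isolated-empty noNeighbour)
    ... | pendant t s t∈nodes s∈nodes t~s onlyS =
      contractPendant D t∈nodes s∈nodes t~s onlyS (pendant-bag⊆ onlyS)

  noCentredDecomposition : ¬ CentredDecomposition G
  noCentredDecomposition =
    WF.All.wfRec (On.wellFounded (∣_∣ ∘ nodes) <-wellFounded) 0ℓ (λ _ → ⊥) descend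
    where
    descend : ∀ D → (∀ {D′} → D′ ≺ D → ⊥) → ⊥
    descend D smaller with D′ , D′≺D ← removeLeaf D = smaller {D′} D′≺D

dominatedVertex : ∀ {n} (G : Graph (suc (suc n))) → CentredDecomposition G → HasDominatedVertex G
dominatedVertex G D =
  decidable-stable (hasDominatedVertex? G) λ undominated → Undominated.noCentredDecomposition G undominated D

deo-byDeletion : ∀ {n} {G : Graph (suc n)} → HasDominatedVertex G → CentredDecomposition G →
                 (∀ (G′ : Graph n) → CentredDecomposition G′ → DEOPermutation G′) → DEOPermutation G
deo-byDeletion {G = G} (u , w , d) D deo = deo-insertDominated {G = G} d (deo (deleteVertex G u) (deleteDominated d D))

centred⇒deo : ∀ n (G : Graph n) → CentredDecomposition G → DEOPermutation G
centred⇒deo zero          G _ = deo-≤1 G z≤n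
centred⇒deo (suc zero)    G _ = deo-≤1 G (s≤s z≤n)
centred⇒deo (suc (suc n)) G D = deo-byDeletion (dominatedVertex G D) D (centred⇒deo (suc n))

lemma8 : ∀ {n : ℕ} (G : Graph n) → Connected G → TreeBreadthLe1 G → HasDEO G
lemma8 {n} G _ tb with π , deo ← centred⇒deo n G (fromTreeBreadthLe1 tb) = π ⟨$⟩ʳ_ , deo
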